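{- Let $f$ be a super edge-magic labeling of a digraph $D$ and let $h:E(D)\to\mathcal{S}_p^k$ be any function. Then there exists $\bar h:E(D)\to\mathcal{S}_p^{p+3-k}$ such that $(\hat f)_c\simeq\widehat{f_c}$, where $(\hat f)_c$ is the super edge-magic complementary labeling of the labeling $\hat f$ of $D\otimes_h\mathcal{S}_p^k$ induced by $f$, and $\widehat{f_c}$ is the labeling of $D\otimes_{\bar h}\mathcal{S}_p^{p+3-k}$ induced by the super edge-magic complementary labeling $f_c$ of $f$. Moreover, $\mathrm{val}((\hat f)_c)=\mathrm{val}(\widehat{f_c})$.
   Context: Digraphs may have loops but no multiple arcs. $[a,b]=\{a,\dots,b\}$. An edge-magic labeling of a $(p,q)$-(di)graph $G$ is a bijection $f:V(G)\cup E(G)\to[1,p+q]$ with $f(x)+f(xy)+f(y)=\mathrm{val}(f)$ constant over edges; super if $f(V(G))=[1,p]$. The super edge-magic complementary labeling $f_c$ of a super edge-magic labeling $f$ of a $(p,q)$-graph is $f_c(x)=p+1-f(x)$ on vertices and $f_c(xy)=2p+q+1-f(xy)$ on edges (super edge-magic of valence $4p+q+3-\mathrm{val}(f)$). $\mathcal{S}_p^k$: the set of digraphs $F$ with vertex set $[1,p]$, exactly $p$ arcs, and $\{i+j:(i,j)\in E(F)\}=[k,k+p-1]$. For $h$ from $E(D)$ to a family of digraphs with common vertex set $V$, $D\otimes_h\Gamma$ has vertex set $V(D)\times V$ and arcs $((a,i),(b,j))$ with $(a,b)\in E(D)$, $(i,j)\in E(h(a,b))$. For a (super) edge-magic labeling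 $g$ of $D$ and $h:E(D)\to\mathcal{S}_p^k$, the induced labeling $\hat g$ of $D\otimes_h\mathcal{S}_p^k$ is $\hat g(a,i)=p(g(a)-1)+i$, $\hat g((a,i),(b,j))=p(g((a,b))-1)+k+p-(i+j)$; it is (super) edge-magic. $\simeq$ means there is a digraph isomorphism carrying one labeling to the other. -}

module Defs where

open import Data.Nat using (ℕ; zero; suc; _+_; _*_; _∸_; _≤_; _<_)
open import Data.Bool using (Bool; true; false; T)
open import Data.Unit using (tt)
open import Data.Fin using (Fin; toℕ)
open import Data.Fin.Properties using (*↔×)
open import Data.List using (List; map; allFin; concatMap)
open import Data.Nat.ListAction using (sum)
open import Data.Product using (Σ; Σ-syntax; ∃; ∃-syntax; _×_; _,_; proj₁; proj₂)
open import Data.Product.Function.NonDependent.Propositional using (_×-↔_)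
open import Data.Sum using (_⊎_; inj₁; inj₂)
open import Function.Bundles using (_↔_; Inverse)
open import Function.Properties.Inverse using (↔-trans; ↔-sym; ↔-refl)
open import Function.Definitions using (Injective)
open import Relation.Binary.PropositionalEquality using (_≡_; subst; sym)

-- Digraphs: a finite vertex type (in bijection with Fin order) and a
-- Boolean adjacency relation.  Loops are allowed; multiple arcs are
-- impossible by construction.

record Digraph : Set₁ where
  field
    V     : Set
    order : ℕ
    enum  : V ↔ Fin order
    adj   : V → V → Bool

open Digraph public

Arc : Digraph → Set
Arc G = Σ[ x ∈ V G ] Σ[ y ∈ V G ] T (adj G x y)

b2n : Bool → ℕ
b2n true  = 1
b2n false = 0

countPairs : (n : ℕ) → (Fin n → Fin n → Bool) → ℕ
countPairs n F = sum (concatMap (λ i → map (λ j → b2n (F i j)) (allFin n)) (allFin n))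

size : Digraph → ℕ
size G = order G

nArcs : Digraph → ℕ
nArcs G = countPairs (order G)
  (λ i j → adj G (Inverse.from (enum G) i) (Inverse.from (enum G) j))

record Labeling (G : Digraph) : Set where
  field
    vl : V G → ℕ
    el : Arc G → ℕ

open Labeling public

lab : {G : Digraph} → Labeling G → V G ⊎ Arc G → ℕ
lab f (inj₁ x) = vl f x
lab f (inj₂ e) = el f e

IsBijectiveLabeling : (G : Digraph) → Labeling G → Set
IsBijectiveLabeling G f =
  (∀ z → 1 ≤ lab f z × lab f z ≤ size G + nArcs G)
  × Injective _≡_ _≡_ (lab f)
  × (∀ l → 1 ≤ l → l ≤ size G + nArcs G → ∃[ z ] lab f z ≡ l)

HasValence : (G : Digraph) → Labeling G → ℕ → Set
HasValence G f v = (e : Arc G) →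
  vl f (proj₁ e) + el f e + vl f (proj₁ (proj₂ e)) ≡ v

IsEdgeMagic : (G : Digraph) → Labeling G → Set
IsEdgeMagic G f = IsBijectiveLabeling G f × ∃[ v ] HasValence G f v

IsSuperEdgeMagic : (G : Digraph) → Labeling G → Set
IsSuperEdgeMagic G f = IsEdgeMagic G f
  × (∀ x → 1 ≤ vl f x × vl f x ≤ size G)
  × (∀ l → 1 ≤ l → l ≤ size G → ∃[ x ] vl f x ≡ l)

complement : (G : Digraph) → Labeling G → Labeling G
complement G f = record
  { vl = λ x → suc (size G) ∸ vl f x
  ; el = λ e → suc (2 * size G + nArcs G) ∸ el f e }

-- The family S_p^k.  A digraph with vertex set [1,p] is encoded by an
-- adjacency on Fin p, vertex i : Fin p standing for the integer toℕ i + 1.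

val : {p : ℕ} → Fin p → ℕ
val i = suc (toℕ i)

InS : (p k : ℕ) → (Fin p → Fin p → Bool) → Set
InS p k F =
  countPairs p F ≡ p
  × (∀ i j → T (F i j) → k ≤ val i + val j × val i + val j < k + p)
  × (∀ s → k ≤ s → s < k + p → ∃[ i ] ∃[ j ] (T (F i j) × val i + val j ≡ s))

S : (p k : ℕ) → Set
S p k = Σ (Fin p → Fin p → Bool) (InS p k)

guard : (b : Bool) → (T b → Bool) → Bool
guard true  g = g tt
guard false g = false

guard-T : (b : Bool) (g : T b → Bool) → T (guard b g) → T b
guard-T true  g _ = tt

prod : (D : Digraph) {p k : ℕ} → (Arc D → S p k) → Digraph
prod D {p} h = record
  { V     = V D × Fin p
  ; order = order D * p
  ; enum  = ↔-trans (enum D ×-↔ ↔-refl) (↔-sym *↔×)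
  ; adj   = λ { (a , i) (b , j) →
      guard (adj D a b) (λ pf → proj₁ (h (a , b , pf)) i j) } }

baseArc : (D : Digraph) {p k : ℕ} (h : Arc D → S p k) → Arc (prod D h) → Arc D
baseArc D h ((a , i) , (b , j) , pf) = a , b , guard-T (adj D a b) _ pf

induced : (D : Digraph) {p k : ℕ} (h : Arc D → S p k) → Labeling D → Labeling (prod D h)
induced D {p} {k} h g = record
  { vl = λ { (a , i) → p * (vl g a ∸ 1) + val i }
  ; el = λ { e@((a , i) , (b , j) , pf) →
      p * (el g (baseArc D h e) ∸ 1) + k + p ∸ (val i + val j) } }

record LabeledIso (G₁ : Digraph) (f₁ : Labeling G₁)
                  (G₂ : Digraph) (f₂ : Labeling G₂) : Set where
  field
    φ        : V G₁ ↔ V G₂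
    adj-pres : ∀ x y → adj G₂ (Inverse.to φ x) (Inverse.to φ y) ≡ adj G₁ x y
    vl-pres  : ∀ x → vl f₂ (Inverse.to φ x) ≡ vl f₁ x
    el-pres  : ∀ x y (pf : T (adj G₁ x y)) →
      el f₂ (Inverse.to φ x , Inverse.to φ y , subst T (sym (adj-pres x y)) pf)
        ≡ el f₁ (x , y , pf)

-- Reflecting [1, p] by i ↦ p + 1 − i sends pair sums s ∈ [k, k + p − 1] to
-- 2p + 2 − s ∈ [k', k' + p − 1] with k' = p + 3 − k, so it turns each member of
-- S_p^k into a member of S_p^k'; this is h̄.  The vertex map (a , i) ↦ (a , p + 1 − i)
-- is then the required isomorphism.  Since D ⊗_h S_p^k has np vertices and pq arcs,
-- both sides compute complements inside blocks of length p: complementing within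
-- [1, pN] sends p(c − 1) + r to p(N − c) + (p + 1 − r), which is what f_c does to the
-- block index c (with N = n for vertices and N = 2n + q for arcs) and what the
-- reflection does to the offset r.  Finally a labeling of D ⊗ S_p^k' induced from a
-- labeling of valence w has valence p(w − 2) + k', and valences transfer along the
-- isomorphism.

module Submission where

open import Defs
open import Data.Bool using (Bool; true; false; T)
open import Data.Bool.Properties using (T-irrelevant)
open import Data.Empty using (⊥-elim)
open import Data.Fin using (Fin; zero; suc; toℕ; opposite; _↑ˡ_; _↑ʳ_; combine; remQuot)
open import Data.Fin.Properties using (toℕ<n; opposite-prop; opposite-involutive; remQuot-combine)
import Data.Fin.Permutation as Perm
open import Data.List using (List; []; _∷_; map; tabulate; concatMap; allFin)
open import Data.List.Properties using (map-tabulate)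
open import Data.Nat using (ℕ; zero; suc; _+_; _*_; _∸_; _≤_; _<_; z≤n; s≤s; z<s)
import Data.Nat.ListAction as List
open import Data.Nat.ListAction.Properties using (sum-++)
open import Data.Nat.Properties
open import Data.Nat.Tactic.RingSolver using (solve; solve-∀)
open import Data.Product using (Σ; Σ-syntax; ∃-syntax; _×_; _,_; proj₁; proj₂)
open import Data.Product.Function.NonDependent.Propositional using (_×-↔_)
open import Data.Sum using (inj₂)
open import Data.Unit using (tt)
open import Function using (_∘_; id)
open import Function.Bundles using (Inverse; _↔_)
open import Function.Properties.Inverse using (↔-refl)
open import Relation.Binary.PropositionalEquality

open import Algebra.Properties.Semiring.Sum +-*-semiring
  using (sum-syntax; sum-cong-≗; ∑-comm; ∑-permute; *-distribˡ-sum; sum-replicate-zero)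

sum-concatMap : ∀ {A : Set} (f : A → List ℕ) (xs : List A) →
  List.sum (concatMap f xs) ≡ List.sum (map (List.sum ∘ f) xs)
sum-concatMap f []       = refl
sum-concatMap f (x ∷ xs) = trans (sum-++ (f x) _) (cong (List.sum (f x) +_) (sum-concatMap f xs))

sum-tabulate : ∀ {n} (g : Fin n → ℕ) → List.sum (tabulate g) ≡ ∑[ i < n ] g i
sum-tabulate {zero}  g = refl
sum-tabulate {suc n} g = cong (g zero +_) (sum-tabulate (g ∘ suc))

sum-allFin : ∀ {n} (g : Fin n → ℕ) → List.sum (map g (allFin n)) ≡ ∑[ i < n ] g i
sum-allFin g = trans (cong List.sum (map-tabulate id g)) (sum-tabulate g)

countPairs≡∑∑ : ∀ n F → countPairs n F ≡ ∑[ i < n ] ∑[ j < n ] b2n (F i j)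
countPairs≡∑∑ n F = begin
  countPairs n F ≡⟨ sum-concatMap row (allFin n) ⟩
  List.sum (map (List.sum ∘ row) (allFin n)) ≡⟨ sum-allFin (List.sum ∘ row) ⟩
  ∑[ i < n ] List.sum (row i) ≡⟨ sum-cong-≗ (λ i → sum-allFin (λ j → b2n (F i j))) ⟩
  ∑[ i < n ] ∑[ j < n ] b2n (F i j) ∎
  where
  open ≡-Reasoning
  row : Fin n → List ℕ
  row i = map (λ j → b2n (F i j)) (allFin n)

∑-↑ : ∀ m {n} (g : Fin (m + n) → ℕ) →
  ∑[ i < m + n ] g i ≡ ∑[ i < m ] g (i ↑ˡ n) + ∑[ j < n ] g (m ↑ʳ j)
∑-↑ zero    g = refl
∑-↑ (suc m) g = trans (cong (g zero +_) (∑-↑ m (g ∘ suc))) (sym (+-assoc (g zero) _ _))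

∑-combine : ∀ m {n} (g : Fin (m * n) → ℕ) →
  ∑[ i < m * n ] g i ≡ ∑[ a < m ] ∑[ b < n ] g (combine a b)
∑-combine zero        g = refl
∑-combine (suc m) {n} g =
  trans (∑-↑ n g) (cong (∑[ b < n ] g (b ↑ˡ (m * n)) +_) (∑-combine m (g ∘ (n ↑ʳ_))))

∑-remQuot : ∀ m {n} (g : Fin m × Fin n → ℕ) →
  ∑[ i < m * n ] g (remQuot n i) ≡ ∑[ a < m ] ∑[ b < n ] g (a , b)
∑-remQuot m g =
  trans (∑-combine m _) (sum-cong-≗ λ a → sum-cong-≗ λ b → cong g (remQuot-combine a b))

countPairs-opposite : ∀ n F → countPairs n (λ i j → F (opposite i) (opposite j)) ≡ countPairs n F
countPairs-opposite n F = begin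
  countPairs n (λ i j → F (opposite i) (opposite j))
    ≡⟨ countPairs≡∑∑ n _ ⟩
  ∑[ i < n ] ∑[ j < n ] b2n (F (opposite i) (opposite j))
    ≡⟨ sum-cong-≗ (λ i → ∑-permute (λ j → b2n (F (opposite i) j)) Perm.reverse) ⟨
  ∑[ i < n ] ∑[ j < n ] b2n (F (opposite i) j)
    ≡⟨ ∑-permute (λ i → ∑[ j < n ] b2n (F i j)) Perm.reverse ⟨
  ∑[ i < n ] ∑[ j < n ] b2n (F i j)
    ≡⟨ countPairs≡∑∑ n F ⟨
  countPairs n F ∎
  where open ≡-Reasoning

countPairs-* : ∀ m n (G : Fin m × Fin n → Fin m × Fin n → Bool) →
  countPairs (m * n) (λ u v → G (remQuot n u) (remQuot n v))
    ≡ ∑[ a < m ] ∑[ b < m ] ∑[ x < n ] ∑[ y < n ] b2n (G (a , x) (b , y))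
countPairs-* m n G = begin
  countPairs (m * n) (λ u v → G (remQuot n u) (remQuot n v))
    ≡⟨ countPairs≡∑∑ (m * n) _ ⟩
  ∑[ u < m * n ] ∑[ v < m * n ] b2n (G (remQuot n u) (remQuot n v))
    ≡⟨ ∑-remQuot m (λ z → ∑[ v < m * n ] b2n (G z (remQuot n v))) ⟩
  ∑[ a < m ] ∑[ x < n ] ∑[ v < m * n ] b2n (G (a , x) (remQuot n v))
    ≡⟨ sum-cong-≗ (λ a → sum-cong-≗ λ x → ∑-remQuot m (λ w → b2n (G (a , x) w))) ⟩
  ∑[ a < m ] ∑[ x < n ] ∑[ b < m ] ∑[ y < n ] b2n (G (a , x) (b , y))
    ≡⟨ sum-cong-≗ (λ a → ∑-comm (λ x b → ∑[ y < n ] b2n (G (a , x) (b , y)))) ⟩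
  ∑[ a < m ] ∑[ b < m ] ∑[ x < n ] ∑[ y < n ] b2n (G (a , x) (b , y)) ∎
  where open ≡-Reasoning

S-count : ∀ {p k} (X : S p k) → countPairs p (proj₁ X) ≡ p
S-count (_ , count , _) = count

S-bounds : ∀ {p k} (X : S p k) i j → T (proj₁ X i j) →
  k ≤ val i + val j × val i + val j < k + p
S-bounds (_ , _ , bounded , _) = bounded

countPairs-guard : ∀ p (b : Bool) (F : T b → Fin p → Fin p → Bool) →
  (∀ t → countPairs p (F t) ≡ p) →
  ∑[ x < p ] ∑[ y < p ] b2n (guard b (λ t → F t x y)) ≡ p * b2n b
countPairs-guard p true  F count =
  trans (sym (countPairs≡∑∑ p (F tt))) (trans (count tt) (sym (*-identityʳ p)))
countPairs-guard p false F _ =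
  trans (sum-cong-≗ {p} {x = λ _ → ∑[ y < p ] 0} (λ _ → sum-replicate-zero p))
        (trans (sum-replicate-zero p) (sym (*-zeroʳ p)))

-- The enumeration of prod D h decodes an index by remQuot and then (enum D)⁻¹ × id,
-- so nArcs (prod D h) unfolds to the left-hand side of countPairs-*.
nArcs-prod : (D : Digraph) {p k : ℕ} (h : Arc D → S p k) → nArcs (prod D h) ≡ p * nArcs D
nArcs-prod D {p} h = begin
  nArcs (prod D h)
    ≡⟨ countPairs-* n p (λ (a , x) (b , y) → adj (prod D h) (e a , x) (e b , y)) ⟩
  ∑[ a < n ] ∑[ b < n ] ∑[ x < p ] ∑[ y < p ] b2n (adj (prod D h) (e a , x) (e b , y))
    ≡⟨ sum-cong-≗ (λ a → sum-cong-≗ λ b → countPairs-guard p (adj D (e a) (e b))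
         (λ t → proj₁ (h (e a , e b , t))) (λ t → S-count (h (e a , e b , t)))) ⟩
  ∑[ a < n ] ∑[ b < n ] (p * b2n (adj D (e a) (e b)))
    ≡⟨ sum-cong-≗ (λ a → *-distribˡ-sum p (λ b → b2n (adj D (e a) (e b)))) ⟨
  ∑[ a < n ] (p * ∑[ b < n ] b2n (adj D (e a) (e b)))
    ≡⟨ *-distribˡ-sum p (λ a → ∑[ b < n ] b2n (adj D (e a) (e b))) ⟨
  p * ∑[ a < n ] ∑[ b < n ] b2n (adj D (e a) (e b))
    ≡⟨ cong (p *_) (countPairs≡∑∑ n _) ⟨
  p * nArcs D ∎
  where
  open ≡-Reasoning
  n : ℕ
  n = order D
  e : Fin n → V D
  e = Inverse.from (enum D)

m+n≡o⇒o∸m≡n : ∀ m {n o} → m + n ≡ o → o ∸ m ≡ n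
m+n≡o⇒o∸m≡n m {n} refl = m+n∸m≡n m n

block-complement : ∀ p N c r r' → 1 ≤ c → c ≤ N → r + r' ≡ suc p →
  suc (p * N) ∸ (p * (c ∸ 1) + r) ≡ p * (suc N ∸ c ∸ 1) + r'
block-complement p N (suc c) r r' _ c<N r+r' with m≤n⇒∃[o]m+o≡n c<N
... | d , refl = begin
  suc (p * (suc c + d)) ∸ (p * c + r) ≡⟨ m+n≡o⇒o∸m≡n (p * c + r) split ⟩
  p * d + r'                          ≡⟨ cong (λ x → p * (x ∸ 1) + r') N∸c ⟨
  p * (suc (c + d) ∸ c ∸ 1) + r'      ∎
  where
  open ≡-Reasoning
  N∸c : suc (c + d) ∸ c ≡ suc d
  N∸c = trans (cong (_∸ c) (sym (+-suc c d))) (m+n∸m≡n c (suc d))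
  split : p * c + r + (p * d + r') ≡ suc (p * (suc c + d))
  split = begin
    p * c + r + (p * d + r')   ≡⟨ solve (p ∷ c ∷ d ∷ r ∷ r' ∷ []) ⟩
    p * c + p * d + (r + r')   ≡⟨ cong (p * c + p * d +_) r+r' ⟩
    p * c + p * d + suc p      ≡⟨ solve (p ∷ c ∷ d ∷ []) ⟩
    suc (p * (suc c + d))      ∎

offset-complement : ∀ {p k k' s s'} → k + k' ≡ p + 3 → s + s' ≡ suc p + suc p →
  s ≤ k + p → s' ≤ k' + p → (k + p ∸ s) + (k' + p ∸ s') ≡ suc p
offset-complement {p} {k} {k'} {s} {s'} k+k' s+s' s≤ s'≤ =
  +-cancelʳ-≡ (suc p + suc p) (a + b) (suc p) (begin
    a + b + (suc p + suc p)   ≡⟨ cong (a + b +_) s+s' ⟨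
    a + b + (s + s')          ≡⟨ interchange a b s s' ⟩
    (s + a) + (s' + b)        ≡⟨ cong₂ _+_ (m+[n∸m]≡n s≤) (m+[n∸m]≡n s'≤) ⟩
    (k + p) + (k' + p)        ≡⟨ solve (k ∷ k' ∷ p ∷ []) ⟩
    (k + k') + (p + p)        ≡⟨ cong (_+ (p + p)) k+k' ⟩
    p + 3 + (p + p)           ≡⟨ solve (p ∷ []) ⟩
    suc p + (suc p + suc p)   ∎)
  where
  open ≡-Reasoning
  a b : ℕ
  a = k + p ∸ s
  b = k' + p ∸ s'
  interchange : ∀ a b s s' → a + b + (s + s') ≡ (s + a) + (s' + b)
  interchange = solve-∀

reflect-interval : ∀ {p k k' s s'} → k + k' ≡ p + 3 → s + s' ≡ suc p + suc p →
  k ≤ s → s < k + p → k' ≤ s' × s' < k' + p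
reflect-interval {p} {k} {k'} {s} {s'} k+k' s+s' k≤s s<k+p
  with m≤n⇒∃[o]m+o≡n k≤s | m≤n⇒∃[o]m+o≡n s<k+p
... | a , refl | b , s+b≡k+p =
    subst (k' ≤_) k'+b≡s' (m≤m+n k' b)
  , subst (s' <_) s'+a≡k'+p (m<m+n s' z<s)
  where
  open ≡-Reasoning
  k'+b≡s' : k' + b ≡ s'
  k'+b≡s' = +-cancelʳ-≡ (suc (k + a)) (k' + b) s' (begin
    k' + b + suc (k + a)      ≡⟨ solve (k' ∷ b ∷ k ∷ a ∷ []) ⟩
    k' + (suc (k + a) + b)    ≡⟨ cong (k' +_) s+b≡k+p ⟩
    k' + (k + p)              ≡⟨ solve (k' ∷ k ∷ p ∷ []) ⟩
    (k + k') + p              ≡⟨ cong (_+ p) k+k' ⟩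
    p + 3 + p                 ≡⟨ solve (p ∷ []) ⟩
    suc (suc p + suc p)       ≡⟨ cong suc s+s' ⟨
    suc (k + a + s')          ≡⟨ solve (k ∷ a ∷ s' ∷ []) ⟩
    s' + suc (k + a)          ∎)
  s'+a≡k'+p : s' + suc a ≡ k' + p
  s'+a≡k'+p = +-cancelʳ-≡ k (s' + suc a) (k' + p) (begin
    s' + suc a + k            ≡⟨ solve (s' ∷ a ∷ k ∷ []) ⟩
    suc (k + a + s')          ≡⟨ cong suc s+s' ⟩
    suc (suc p + suc p)       ≡⟨ solve (p ∷ []) ⟩
    p + 3 + p                 ≡⟨ cong (_+ p) k+k' ⟨
    (k + k') + p              ≡⟨ solve (k ∷ k' ∷ p ∷ []) ⟩
    k' + p + k                ∎)

[A∸a]+[B∸b]+[C∸c]≡[A+B+C]∸[a+b+c] : ∀ {a b c A B C} → a ≤ A → b ≤ B → c ≤ C →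
  (A ∸ a) + (B ∸ b) + (C ∸ c) ≡ A + B + C ∸ (a + b + c)
[A∸a]+[B∸b]+[C∸c]≡[A+B+C]∸[a+b+c] {a} {b} {c} {A} {B} {C} a≤A b≤B c≤C =
  sym (m+n≡o⇒o∸m≡n (a + b + c) (begin
  a + b + c + ((A ∸ a) + (B ∸ b) + (C ∸ c))
    ≡⟨ interchange a b c (A ∸ a) (B ∸ b) (C ∸ c) ⟩
  (a + (A ∸ a)) + (b + (B ∸ b)) + (c + (C ∸ c))
    ≡⟨ cong₂ _+_ (cong₂ _+_ (m+[n∸m]≡n a≤A) (m+[n∸m]≡n b≤B)) (m+[n∸m]≡n c≤C) ⟩
  A + B + C ∎))
  where
  open ≡-Reasoning
  interchange : ∀ a b c a' b' c' → a + b + c + (a' + b' + c') ≡ (a + a') + (b + b') + (c + c')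
  interchange = solve-∀

+-+-∸-assoc : ∀ x {k p s} → s ≤ k + p → x + k + p ∸ s ≡ x + (k + p ∸ s)
+-+-∸-assoc x {k} {p} {s} s≤ = trans (cong (_∸ s) (+-assoc x k p)) (+-∸-assoc x s≤)

block-valence : ∀ p K {vi vj ga ge gb} → 1 ≤ ga → 1 ≤ ge → 1 ≤ gb → vi + vj ≤ K + p →
  p * (ga ∸ 1) + vi + (p * (ge ∸ 1) + K + p ∸ (vi + vj)) + (p * (gb ∸ 1) + vj)
    ≡ p * (ga + ge + gb ∸ 2) + K
block-valence p K {vi} {vj} {suc A} {suc E} {suc B} _ _ _ s≤ = begin
  p * A + vi + (p * E + K + p ∸ (vi + vj)) + (p * B + vj)
    ≡⟨ cong (λ x → p * A + vi + x + (p * B + vj)) (+-+-∸-assoc (p * E) s≤) ⟩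
  p * A + vi + (p * E + r) + (p * B + vj)
    ≡⟨ collect p A E B vi vj r ⟩
  p * (A + E + B) + (vi + vj + r)
    ≡⟨ cong (p * (A + E + B) +_) (m+[n∸m]≡n s≤) ⟩
  p * (A + E + B) + (K + p)
    ≡⟨ solve (p ∷ A ∷ E ∷ B ∷ K ∷ []) ⟩
  p * suc (A + E + B) + K
    ≡⟨ cong (λ x → p * x + K) w∸2 ⟨
  p * (suc A + suc E + suc B ∸ 2) + K ∎
  where
  open ≡-Reasoning
  r : ℕ
  r = K + p ∸ (vi + vj)
  collect : ∀ p A E B vi vj r →
    p * A + vi + (p * E + r) + (p * B + vj) ≡ p * (A + E + B) + (vi + vj + r)
  collect = solve-∀
  w∸2 : suc A + suc E + suc B ∸ 2 ≡ suc (A + E + B)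
  w∸2 = m+n≡o⇒o∸m≡n 2 (regroup A E B)
    where
    regroup : ∀ A E B → 2 + suc (A + E + B) ≡ suc A + suc E + suc B
    regroup = solve-∀

edge-complement : ∀ {p k k' s s'} N c → k + k' ≡ p + 3 → s + s' ≡ suc p + suc p →
  k ≤ s → s < k + p → 1 ≤ c → c ≤ N →
  suc (p * N) ∸ (p * (c ∸ 1) + k + p ∸ s) ≡ p * (suc N ∸ c ∸ 1) + k' + p ∸ s'
edge-complement {p} {k} {k'} {s} {s'} N c k+k' s+s' k≤s s<k+p 1≤c c≤N
  with reflect-interval k+k' s+s' k≤s s<k+p
... | _ , s'<k'+p = begin
  suc (p * N) ∸ (p * (c ∸ 1) + k + p ∸ s)
    ≡⟨ cong (suc (p * N) ∸_) (+-+-∸-assoc (p * (c ∸ 1)) (<⇒≤ s<k+p)) ⟩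
  suc (p * N) ∸ (p * (c ∸ 1) + (k + p ∸ s))
    ≡⟨ block-complement p N c _ _ 1≤c c≤N
         (offset-complement k+k' s+s' (<⇒≤ s<k+p) (<⇒≤ s'<k'+p)) ⟩
  p * (suc N ∸ c ∸ 1) + (k' + p ∸ s')
    ≡⟨ +-+-∸-assoc (p * (suc N ∸ c ∸ 1)) (<⇒≤ s'<k'+p) ⟨
  p * (suc N ∸ c ∸ 1) + k' + p ∸ s' ∎
  where open ≡-Reasoning

val-opposite : ∀ {p} (i : Fin p) → val i + val (opposite i) ≡ suc p
val-opposite {p} i = begin
  suc (toℕ i) + suc (toℕ (opposite i)) ≡⟨ cong (λ x → suc (toℕ i) + suc x) (opposite-prop i) ⟩
  suc (toℕ i) + suc (p ∸ suc (toℕ i))  ≡⟨ +-suc (suc (toℕ i)) _ ⟩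
  suc (suc (toℕ i) + (p ∸ suc (toℕ i))) ≡⟨ cong suc (m+[n∸m]≡n (toℕ<n i)) ⟩
  suc p ∎
  where open ≡-Reasoning

val-pair-opposite : ∀ {p} (i j : Fin p) →
  (val i + val j) + (val (opposite i) + val (opposite j)) ≡ suc p + suc p
val-pair-opposite i j =
  trans (interchange (val i) (val j) _ _) (cong₂ _+_ (val-opposite i) (val-opposite j))
  where
  interchange : ∀ a b c d → (a + b) + (c + d) ≡ (a + c) + (b + d)
  interchange = solve-∀

InS-offset≤ : ∀ {m k F} → InS (suc m) k F → k ≤ suc (suc m)
InS-offset≤ {m} {k} (_ , _ , onto)
  with onto (k + m) (m≤m+n k m) (≤-reflexive (sym (+-suc k m)))
... | i , j , _ , vi+vj≡k+m = +-cancelʳ-≤ m k (suc (suc m)) (begin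
  k + m           ≡⟨ vi+vj≡k+m ⟨
  val i + val j   ≤⟨ +-mono-≤ (toℕ<n i) (toℕ<n j) ⟩
  suc m + suc m   ≡⟨ +-suc (suc m) m ⟩
  suc (suc m) + m ∎)
  where open ≤-Reasoning

-- The index only witnesses p > 0: for p = 0 every k is allowed and p + 3 ∸ k may truncate.
InS-offset-reflect : ∀ {p k F} → InS p k F → Fin p → k + (p + 3 ∸ k) ≡ p + 3
InS-offset-reflect {suc m} inS _ = m+[n∸m]≡n (≤-trans (InS-offset≤ inS) 2+m≤m+4)
  where
  2+m≤m+4 : suc (suc m) ≤ suc m + 3
  2+m≤m+4 = subst (_≤ suc m + 3) (+-comm (suc m) 1) (+-monoʳ-≤ (suc m) (s≤s z≤n))

reflectF : ∀ {p} → (Fin p → Fin p → Bool) → Fin p → Fin p → Bool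
reflectF F i j = F (opposite i) (opposite j)

reflect-InS : ∀ {p k F} → InS p k F → InS p (p + 3 ∸ k) (reflectF F)
reflect-InS {zero} {k} _ = refl , (λ ()) , λ s k'≤s s<k' →
  ⊥-elim (<⇒≱ (subst (s <_) (+-identityʳ (3 ∸ k)) s<k') k'≤s)
reflect-InS {suc m} {k} {F} inS@(count , bounded , onto) =
  trans (countPairs-opposite p F) count , bounded' , onto'
  where
  p k' : ℕ
  p = suc m
  k' = p + 3 ∸ k
  k+k' : k + k' ≡ p + 3
  k+k' = InS-offset-reflect inS zero
  bounded' : ∀ i j → T (reflectF F i j) → k' ≤ val i + val j × val i + val j < k' + p
  bounded' i j t with bounded (opposite i) (opposite j) t
  ... | k≤ , <k+p = reflect-interval k+k' pair-sums k≤ <k+p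
    where
    pair-sums : val (opposite i) + val (opposite j) + (val i + val j) ≡ suc p + suc p
    pair-sums = trans (+-comm _ (val i + val j)) (val-pair-opposite i j)
  below-double : ∀ {s} → s < k' + p → s ≤ suc p + suc p
  below-double s<k'+p =
    ≤-pred (≤-trans s<k'+p (subst (k' + p ≤_) (bound p) (+-monoˡ-≤ p (m∸n≤m (p + 3) k))))
    where
    bound : ∀ p → p + 3 + p ≡ suc (suc p + suc p)
    bound = solve-∀
  onto' : ∀ s → k' ≤ s → s < k' + p → ∃[ i ] ∃[ j ] (T (reflectF F i j) × val i + val j ≡ s)
  onto' s k'≤s s<k'+p
    with reflect-interval (trans (+-comm k' k) k+k') (m+[n∸m]≡n (below-double s<k'+p))
                          k'≤s s<k'+p
  ... | k≤s₀ , s₀<k+p with onto _ k≤s₀ s₀<k+p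
  ... | i , j , t , vi+vj≡s₀ =
      opposite i , opposite j
    , subst₂ (λ x y → T (F x y)) (sym (opposite-involutive i)) (sym (opposite-involutive j)) t
    , +-cancelˡ-≡ s₀ _ s (begin
        s₀ + s'                       ≡⟨ cong (_+ s') vi+vj≡s₀ ⟨
        val i + val j + s'            ≡⟨ val-pair-opposite i j ⟩
        suc p + suc p                 ≡⟨ m+[n∸m]≡n (below-double s<k'+p) ⟨
        s + s₀                        ≡⟨ +-comm s s₀ ⟩
        s₀ + s                        ∎)
    where
    open ≡-Reasoning
    s₀ s' : ℕ
    s₀ = suc p + suc p ∸ s
    s' = val (opposite i) + val (opposite j)

reflectS : ∀ {p k} → S p k → S p (p + 3 ∸ k)
reflectS (F , inS) = reflectF F , reflect-InS inS

guard-cong : ∀ b {g g' : T b → Bool} → (∀ t → g t ≡ g' t) → guard b g ≡ guard b g'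
guard-cong true  g≡g' = g≡g' tt
guard-cong false _    = refl

guard-elim : ∀ b {g : T b → Bool} → T (guard b g) → Σ (T b) (T ∘ g)
guard-elim true t = tt , t

complement-induced-iso : (D : Digraph) (f : Labeling D) {p k : ℕ} (h : Arc D → S p k) →
  (∀ x → 1 ≤ vl f x × vl f x ≤ order D) →
  (∀ e → 1 ≤ el f e × el f e ≤ 2 * order D + nArcs D) →
  LabeledIso (prod D h) (complement (prod D h) (induced D h f))
             (prod D (reflectS ∘ h)) (induced D (reflectS ∘ h) (complement D f))
complement-induced-iso D f {p} {k} h vertexBounds edgeBounds = record
  { φ = φ ; adj-pres = adj-pres ; vl-pres = vl-pres ; el-pres = el-pres }
  where
  n q : ℕ
  n = order D
  q = nArcs D
  φ : (V D × Fin p) ↔ (V D × Fin p)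
  φ = ↔-refl ×-↔ Perm.reverse
  open Inverse φ using (to)
  adj-pres : ∀ x y → adj (prod D (reflectS ∘ h)) (to x) (to y) ≡ adj (prod D h) x y
  adj-pres (a , i) (b , j) = guard-cong (adj D a b) λ t →
    cong₂ (proj₁ (h (a , b , t))) (opposite-involutive i) (opposite-involutive j)
  vl-pres : ∀ x → vl (induced D (reflectS ∘ h) (complement D f)) (to x)
                ≡ vl (complement (prod D h) (induced D h f)) x
  vl-pres (a , i) = sym (trans (cong (λ N → suc N ∸ (p * (vl f a ∸ 1) + val i)) (*-comm n p))
    (block-complement p n (vl f a) (val i) _
      (proj₁ (vertexBounds a)) (proj₂ (vertexBounds a)) (val-opposite i)))
  size-prod : 2 * (n * p) + nArcs (prod D h) ≡ p * (2 * n + q)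
  size-prod = trans (cong (2 * (n * p) +_) (nArcs-prod D h)) (distrib n q p)
    where
    distrib : ∀ n q p → 2 * (n * p) + p * q ≡ p * (2 * n + q)
    distrib = solve-∀
  el-pres : ∀ x y (t : T (adj (prod D h) x y)) →
    el (induced D (reflectS ∘ h) (complement D f)) (to x , to y , subst T (sym (adj-pres x y)) t)
      ≡ el (complement (prod D h) (induced D h f)) (x , y , t)
  el-pres (a , i) (b , j) t with guard-elim (adj D a b) t
  ... | tD , tF = sym (begin
    suc (2 * (n * p) + nArcs (prod D h)) ∸ (p * (el f e₀ ∸ 1) + k + p ∸ (val i + val j))
      ≡⟨ cong (λ N → suc N ∸ (p * (el f e₀ ∸ 1) + k + p ∸ (val i + val j))) size-prod ⟩
    suc (p * (2 * n + q)) ∸ (p * (el f e₀ ∸ 1) + k + p ∸ (val i + val j))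
      ≡⟨ edge-complement _ _ (InS-offset-reflect (proj₂ (h (a , b , tD))) i)
           (val-pair-opposite i j) (proj₁ sum-bounds) (proj₂ sum-bounds)
           (proj₁ (edgeBounds e₀)) (proj₂ (edgeBounds e₀)) ⟩
    p * (suc (2 * n + q) ∸ el f e₀ ∸ 1) + (p + 3 ∸ k) + p ∸ (val (opposite i) + val (opposite j))
      ≡⟨ cong (λ t' → p * (suc (2 * n + q) ∸ el f (a , b , t') ∸ 1) + (p + 3 ∸ k) + p
                        ∸ (val (opposite i) + val (opposite j))) (T-irrelevant _ _) ⟩
    el (induced D (reflectS ∘ h) (complement D f))
       (to (a , i) , to (b , j) , subst T (sym (adj-pres (a , i) (b , j))) t) ∎)
    where
    open ≡-Reasoning
    e₀ : Arc D
    e₀ = a , b , guard-T (adj D a b) _ t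
    sum-bounds : k ≤ val i + val j × val i + val j < k + p
    sum-bounds = S-bounds (h (a , b , tD)) i j tF

LabeledIso-valence : ∀ {G₁ f₁ G₂ f₂ v} →
  LabeledIso G₁ f₁ G₂ f₂ → HasValence G₂ f₂ v → HasValence G₁ f₁ v
LabeledIso-valence iso valence (x , y , t) =
  trans (sym (cong₂ _+_ (cong₂ _+_ (vl-pres x) (el-pres x y t)) (vl-pres y)))
        (valence (to φ x , to φ y , subst T (sym (adj-pres x y)) t))
  where
  open LabeledIso iso
  open Inverse using (to)

complement-valence : (G : Digraph) (f : Labeling G) {v : ℕ} →
  (∀ x → vl f x ≤ suc (size G)) → (∀ e → el f e ≤ suc (2 * size G + nArcs G)) →
  HasValence G f v →
  HasValence G (complement G f) (suc (size G) + suc (2 * size G + nArcs G) + suc (size G) ∸ v)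
complement-valence G f vl≤ el≤ valence e@(x , y , _) =
  trans ([A∸a]+[B∸b]+[C∸c]≡[A+B+C]∸[a+b+c] (vl≤ x) (el≤ e) (vl≤ y))
        (cong (_ ∸_) (valence e))

induced-valence : (D : Digraph) {p K : ℕ} (h : Arc D → S p K) (g : Labeling D) {w : ℕ} →
  (∀ x → 1 ≤ vl g x) → (∀ e → 1 ≤ el g e) → HasValence D g w →
  HasValence (prod D h) (induced D h g) (p * (w ∸ 2) + K)
induced-valence D {p} {K} h g vl≥1 el≥1 valence ((a , i) , (b , j) , t)
  with guard-elim (adj D a b) t
... | tD , tF = trans
  (block-valence p K (vl≥1 a) (el≥1 e) (vl≥1 b)
    (<⇒≤ (proj₂ (S-bounds (h (a , b , tD)) i j tF))))
  (cong (λ w → p * (w ∸ 2) + K) (valence e))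
  where
  e : Arc D
  e = baseArc D h ((a , i) , (b , j) , t)

proposition2p6 : (D : Digraph) (f : Labeling D) → IsSuperEdgeMagic D f →
    (p k : ℕ) (h : Arc D → S p k) →
    Σ[ hb ∈ (Arc D → S p (p + 3 ∸ k)) ]
      (LabeledIso (prod D h) (complement (prod D h) (induced D h f))
                  (prod D hb) (induced D hb (complement D f))
      × ∃[ v ] (HasValence (prod D h) (complement (prod D h) (induced D h f)) v
               × HasValence (prod D hb) (induced D hb (complement D f)) v))
proposition2p6 D f (((labelBounds , _ , _) , v , valence) , vertexBounds , _) p k h =
    reflectS ∘ h , iso
  , v' , LabeledIso-valence iso induced-complement-valence , induced-complement-valence
  where
  n q v' : ℕ
  n = order D
  q = nArcs D
  v' = p * (suc n + suc (2 * n + q) + suc n ∸ v ∸ 2) + (p + 3 ∸ k)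
  edgeBounds : ∀ e → 1 ≤ el f e × el f e ≤ 2 * n + q
  edgeBounds e with labelBounds (inj₂ e)
  ... | 1≤ , ≤n+q = 1≤ , ≤-trans ≤n+q (+-monoˡ-≤ q (m≤m+n n _))
  iso : LabeledIso (prod D h) (complement (prod D h) (induced D h f))
                   (prod D (reflectS ∘ h)) (induced D (reflectS ∘ h) (complement D f))
  iso = complement-induced-iso D f h vertexBounds edgeBounds
  induced-complement-valence :
    HasValence (prod D (reflectS ∘ h)) (induced D (reflectS ∘ h) (complement D f)) v'
  induced-complement-valence = induced-valence D (reflectS ∘ h) (complement D f)
    (λ x → m<n⇒0<n∸m (s≤s (proj₂ (vertexBounds x))))
    (λ e → m<n⇒0<n∸m (s≤s (proj₂ (edgeBounds e))))
    (complement-valence D f (λ x → m≤n⇒m≤1+n (proj₂ (vertexBounds x)))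
                            (λ e → m≤n⇒m≤1+n (proj₂ (edgeBounds e))) valence)
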